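{- Let $\mathcal{R}$ be a field of characteristic $0$. Then every $\mathsf{PC}_\mathcal{R}$ derivation of $x_1+\dots+x_n+1=0$ from the set of equations $\{x_i^2-x_i=0 : i=1,\dots,n\}\cup\{(x_1+\dots+x_n+1)^2=0\}$ has degree $\Omega(n)$.
   Context: $\mathsf{PC}_\mathcal{R}$ derivation of $q=0$ from a set of equations $\mathcal{F}$: a sequence of equations ending in $q=0$, each a member of $\mathcal{F}$, or $0=0$, or obtained from earlier lines by the addition rule (from $p=0,r=0$ derive $ap+br=0$, $a,b\in\mathcal{R}$) or the multiplication rule (from $p=0$ derive $px_i=0$, $x_i$ a variable). The degree of a derivation is the maximum degree of any polynomial appearing in it. -}

module Defs where

open import Level using (_⊔_)
open import Algebra.Bundles using (CommutativeRing)
open import Data.Nat as ℕ using (ℕ; zero; suc; _<_)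
open import Data.Nat.Properties using () renaming (_≟_ to _≟ℕ_)
open import Data.Fin using (Fin; fromℕ; toℕ)
open import Data.Vec using (Vec; replicate; _[_]%=_; lookup)
open import Data.Vec.Properties using (≡-dec)
import Data.Vec as V
open import Data.List using (List; []; _∷_; _++_; map; concatMap; foldr)
open import Data.Product using (_×_; _,_; Σ; ∃; ∃-syntax)
open import Data.Sum using (_⊎_)
open import Relation.Nullary using (¬_; yes; no)

record IsField {c ℓ} (R : CommutativeRing c ℓ) : Set (c ⊔ ℓ) where
  open CommutativeRing R
  field
    1≉0     : ¬ (1# ≈ 0#)
    inverse : ∀ x → ¬ (x ≈ 0#) → ∃[ y ] (x * y ≈ 1#)

module _ {c ℓ} (R : CommutativeRing c ℓ) where
  open CommutativeRing R
  natR : ℕ → Carrier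
  natR zero = 0#
  natR (suc m) = 1# + natR m

  CharZero : Set ℓ
  CharZero = ∀ m → ¬ (natR (suc m) ≈ 0#)

module PC {c ℓ} (R : CommutativeRing c ℓ) (n : ℕ) where
  open CommutativeRing R

  Monomial : Set
  Monomial = Vec ℕ n

  totalDeg : Monomial → ℕ
  totalDeg = V.sum

  -- a polynomial is a finite formal sum of terms (coefficient, monomial);
  -- its actual coefficients are given by `coeff` below.
  Poly : Set c
  Poly = List (Carrier × Monomial)

  coeff : Poly → Monomial → Carrier
  coeff [] m = 0#
  coeff ((a , m′) ∷ p) m with ≡-dec _≟ℕ_ m′ m
  ... | yes _ = a + coeff p m
  ... | no  _ = coeff p m

  _≈P_ : Poly → Poly → Set ℓ
  p ≈P q = ∀ m → coeff p m ≈ coeff q m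

  0P : Poly
  0P = []

  constP : Carrier → Poly
  constP a = (a , replicate n 0) ∷ []

  var : Fin n → Poly
  var i = (1# , (replicate n 0 [ i ]%= suc)) ∷ []

  _+P_ : Poly → Poly → Poly
  p +P q = p ++ q

  scale : Carrier → Poly → Poly
  scale a = map (λ { (b , m) → (a * b , m) })

  _*P_ : Poly → Poly → Poly
  p *P q = concatMap (λ { (a , m) → map (λ { (b , m′) → (a * b , V.zipWith ℕ._+_ m m′) }) q }) p

  mulVar : Poly → Fin n → Poly
  mulVar p i = p *P var i

  DegLE : Poly → ℕ → Set ℓ
  DegLE p d = ∀ m → d < totalDeg m → coeff p m ≈ 0#

  -- A PC_R derivation from the set of equations F (a predicate on polynomials):
  -- a nonempty sequence of lines p_0,…,p_L (each line "p_j = 0"), each justified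
  -- by being in F, being 0, or by the addition/multiplication rule from earlier lines.
  record Derivation {f} (F : Poly → Set f) : Set (c ⊔ ℓ ⊔ f) where
    field
      len   : ℕ
      line  : Fin (suc len) → Poly
      just  : ∀ j →
                F (line j)
              ⊎ line j ≈P 0P
              ⊎ (Σ (Fin (suc len)) λ k → Σ (Fin (suc len)) λ k′ → Σ Carrier λ a → Σ Carrier λ b →
                   toℕ k < toℕ j × toℕ k′ < toℕ j ×
                   line j ≈P (scale a (line k) +P scale b (line k′)))
              ⊎ (Σ (Fin (suc len)) λ k → Σ (Fin n) λ i →
                   toℕ k < toℕ j × line j ≈P mulVar (line k) i)

    conclusion : Poly
    conclusion = line (fromℕ len)

  DerivationOf : ∀ {f} (F : Poly → Set f) → Poly → Set (c ⊔ ℓ ⊔ f)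
  DerivationOf F q = Σ (Derivation F) λ D → Derivation.conclusion D ≈P q

  DerivDegLE : ∀ {f} {F : Poly → Set f} → Derivation F → ℕ → Set ℓ
  DerivDegLE D d = ∀ j → DegLE (Derivation.line D j) d

  sumVars+1 : Poly
  sumVars+1 = foldr (λ i p → var i +P p) (constP 1#) (Data.List.tabulate {n = n} (λ i → i))
    where import Data.List

  Axioms : Poly → Set ℓ
  Axioms p = (∃[ i ] p ≈P ((var i *P var i) +P scale (- 1#) (var i)))
           ⊎ p ≈P (sumVars+1 *P sumVars+1)

{-# OPTIONS --safe #-}
module Submission where

-- Modulo the Boolean axioms x_i² = x_i a polynomial becomes a multilinear one, i.e. a function on the
-- subsets S ⊆ [n]. Let L = 1 + x_1 + … + x_n. Along a derivation of degree t + 2 every line reduces to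
-- L² q with deg q ≤ t: the axioms reduce to 0 and to L², and linear combinations preserve this. For a
-- product x_i · p, the degree bound makes L² q vanish in degree t + 2; since the raising operator U
-- (add one element to S) is injective from level k to level k + m when 2k + m ≤ n, q vanishes in
-- degree t and x_i q again has degree ≤ t. The injectivity is the sl₂ argument: on level k,
-- D Uᵐ⁺¹ − Uᵐ⁺¹ D = (m + 1)(n − 2k − m) Uᵐ for the lowering operator D, and in characteristic 0 this
-- integer can be cancelled. Finally L = L² q forces 1 = L q and then q = 0, which is absurd; hence a
-- refutation needs 2t + 3 > n.

open import Defs
open import Level using (_⊔_)
open import Algebra.Bundles using (CommutativeRing)
open import Data.Nat as ℕ using (ℕ; zero; suc; _∸_; _≤_; _<_; z≤n; s≤s)
import Data.Nat.Properties as ℕ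
open import Data.Bool as Bool using (Bool; true; false; not)
open import Data.Fin using (Fin; zero; suc)
import Data.Fin as Fin
import Data.Fin.Properties as Fin
open import Data.Fin.Subset using (Subset; ∣_∣; ⊥; inside; outside)
open import Data.Fin.Subset.Properties using (∣p∣≤n; ∣⊥∣≡0)
open import Data.Vec using (Vec; []; _∷_; lookup; replicate; zipWith; _[_]≔_; _[_]%=_)
import Data.Vec as Vec
open import Data.Vec.Properties
  using (≡-dec; lookup∘updateAt; lookup∘updateAt′; []≔-idempotent; []≔-commutes; updateAt-id-local)
open import Data.Product using (Σ-syntax; proj₁; proj₂; ∃-syntax; _×_; _,_)
open import Data.Sum using (inj₁; inj₂)
open import Data.Empty using (⊥-elim)
open import Function.Bundles using (_⇔_; mk⇔)
open import Relation.Nullary using (¬_; yes; no; does)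
open import Relation.Nullary.Decidable using (dec-true; dec-false; does-⇔)
open import Relation.Binary.Definitions using (DecidableEquality)
open import Relation.Binary.PropositionalEquality as ≡ using (_≡_; _≢_)

TorsionFree : ∀ {c ℓ} → CommutativeRing c ℓ → Set (c ⊔ ℓ)
TorsionFree R = ∀ m x → natR R (suc m) * x ≈ 0# → x ≈ 0#
  where open CommutativeRing R

module Subsets where
  open ≡ using (refl; cong)

  ∣p[i]≔outside∣ : ∀ {n} (p : Subset n) i → lookup p i ≡ inside → suc ∣ p [ i ]≔ outside ∣ ≡ ∣ p ∣
  ∣p[i]≔outside∣ (inside ∷ p)  zero    _  = refl
  ∣p[i]≔outside∣ (inside ∷ p)  (suc i) eq = cong suc (∣p[i]≔outside∣ p i eq)
  ∣p[i]≔outside∣ (outside ∷ p) (suc i) eq = ∣p[i]≔outside∣ p i eq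

  ∣p[i]≔inside∣ : ∀ {n} (p : Subset n) i → lookup p i ≡ outside → ∣ p [ i ]≔ inside ∣ ≡ suc ∣ p ∣
  ∣p[i]≔inside∣ (outside ∷ p) zero    _  = refl
  ∣p[i]≔inside∣ (inside ∷ p)  (suc i) eq = cong suc (∣p[i]≔inside∣ p i eq)
  ∣p[i]≔inside∣ (outside ∷ p) (suc i) eq = ∣p[i]≔inside∣ p i eq

  lookup-[i]≔ : ∀ {n} (p : Subset n) i b → lookup (p [ i ]≔ b) i ≡ b
  lookup-[i]≔ p i b = lookup∘updateAt i p

  lookup-[j]≔ : ∀ {n} (p : Subset n) i j b → i ≢ j → lookup (p [ j ]≔ b) i ≡ lookup p i
  lookup-[j]≔ p i j b i≢j = lookup∘updateAt′ i j i≢j p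

  [i]≔-lookup : ∀ {n} (p : Subset n) i b → lookup p i ≡ b → p [ i ]≔ b ≡ p
  [i]≔-lookup p i b eq = updateAt-id-local i p (≡.sym eq)

  differ-at : ∀ {n} (p q : Subset n) i → lookup p i ≡ inside → lookup q i ≡ outside → p ≢ q
  differ-at p q i p∋i q∌i refl with ≡.trans (≡.sym p∋i) q∌i
  ... | ()

module Monomials where
  open ≡ using (refl; cong; cong₂)

  _⊞_ : ∀ {k} → Vec ℕ k → Vec ℕ k → Vec ℕ k
  _⊞_ = zipWith ℕ._+_

  unit : ∀ k → Fin k → Vec ℕ k
  unit k i = replicate k 0 [ i ]%= suc

  support : ∀ {k} → Vec ℕ k → Subset k
  support []          = []
  support (zero ∷ m)  = outside ∷ support m
  support (suc _ ∷ m) = inside ∷ support m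

  ⊞-identityʳ : ∀ {k} (m : Vec ℕ k) → m ⊞ replicate k 0 ≡ m
  ⊞-identityʳ []      = refl
  ⊞-identityʳ (x ∷ m) = cong₂ _∷_ (ℕ.+-identityʳ x) (⊞-identityʳ m)

  ⊞-identityˡ : ∀ {k} (m : Vec ℕ k) → replicate k 0 ⊞ m ≡ m
  ⊞-identityˡ []      = refl
  ⊞-identityˡ (x ∷ m) = cong (x ∷_) (⊞-identityˡ m)

  support-⊞unit : ∀ {k} (m : Vec ℕ k) i → support (m ⊞ unit k i) ≡ support m [ i ]≔ inside
  support-⊞unit (x ∷ m) zero rewrite ℕ.+-comm x 1 | ⊞-identityʳ m with x
  ... | zero  = refl
  ... | suc _ = refl
  support-⊞unit (zero ∷ m)  (suc i) = cong (outside ∷_) (support-⊞unit m i)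
  support-⊞unit (suc x ∷ m) (suc i) = cong (inside ∷_) (support-⊞unit m i)

  support-0 : ∀ k → support (replicate k 0) ≡ ⊥
  support-0 zero    = refl
  support-0 (suc k) = cong (outside ∷_) (support-0 k)

  sum-⊞unit : ∀ {k} (m : Vec ℕ k) i → Vec.sum (m ⊞ unit k i) ≡ suc (Vec.sum m)
  sum-⊞unit (x ∷ m) zero    rewrite ⊞-identityʳ m | ℕ.+-comm x 1 = refl
  sum-⊞unit (x ∷ m) (suc i) rewrite sum-⊞unit m i | ℕ.+-identityʳ x = ℕ.+-suc x (Vec.sum m)

  ⊞unit-injective : ∀ {k} (m m′ : Vec ℕ k) i → m ⊞ unit k i ≡ m′ ⊞ unit k i → m ≡ m′
  ⊞unit-injective (x ∷ m) (y ∷ m′) zero eq rewrite ⊞-identityʳ m | ⊞-identityʳ m′ =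
    cong₂ _∷_ (ℕ.+-cancelʳ-≡ 1 x y (cong Vec.head eq)) (cong Vec.tail eq)
  ⊞unit-injective (x ∷ m) (y ∷ m′) (suc i) eq rewrite ℕ.+-identityʳ x | ℕ.+-identityʳ y =
    cong₂ _∷_ (cong Vec.head eq) (⊞unit-injective m m′ i (cong Vec.tail eq))

  ∣support∣≤sum : ∀ {k} (m : Vec ℕ k) → ∣ support m ∣ ≤ Vec.sum m
  ∣support∣≤sum []          = z≤n
  ∣support∣≤sum (zero ∷ m)  = ∣support∣≤sum m
  ∣support∣≤sum (suc x ∷ m) = s≤s (ℕ.≤-trans (∣support∣≤sum m) (ℕ.m≤n+m (Vec.sum m) x))

module RingLemmas {c ℓ} (R : CommutativeRing c ℓ) where
  open CommutativeRing R hiding (zero)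
  open import Algebra.Properties.Ring ring using (-1*x≈-x; x≈y⇒x∙y⁻¹≈ε; x∙y⁻¹≈ε⇒x≈y)
  open import Algebra.Properties.Semiring.Sum semiring using (sum; sum-cong-≋; sum-replicate-zero)

  𝟙 : Bool → Carrier
  𝟙 true  = 1#
  𝟙 false = 0#

  𝟙-guard : ∀ b {x y} → (b ≡ true → x ≈ y) → 𝟙 b * x ≈ 𝟙 b * y
  𝟙-guard true  x≈y = *-congˡ (x≈y ≡.refl)
  𝟙-guard false _   = trans (zeroˡ _) (sym (zeroˡ _))

  +-≈0ʳ : ∀ {x y} → y ≈ 0# → x + y ≈ x
  +-≈0ʳ {x} y≈0 = trans (+-congˡ y≈0) (+-identityʳ x)

  +-≈0ˡ : ∀ {x y} → x ≈ 0# → x + y ≈ y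
  +-≈0ˡ {y = y} x≈0 = trans (+-congʳ x≈0) (+-identityˡ y)

  *-≈0ʳ : ∀ {x y} → y ≈ 0# → x * y ≈ 0#
  *-≈0ʳ {x} y≈0 = trans (*-congˡ y≈0) (zeroʳ x)

  ≈0+≈0 : ∀ {x y} → x ≈ 0# → y ≈ 0# → x + y ≈ 0#
  ≈0+≈0 x≈0 y≈0 = trans (+-≈0ʳ y≈0) x≈0

  difference≈0 : ∀ {x y} → x ≈ y → 1# * x + - 1# * y ≈ 0#
  difference≈0 {x} {y} x≈y = trans (+-cong (*-identityˡ x) (-1*x≈-x y)) (x≈y⇒x∙y⁻¹≈ε x≈y)

  difference≈0⇒≈ : ∀ {x y} → 1# * x + - 1# * y ≈ 0# → x ≈ y
  difference≈0⇒≈ {x} {y} x-y≈0 = x∙y⁻¹≈ε⇒x≈y x y (trans (sym (+-cong (*-identityˡ x) (-1*x≈-x y))) x-y≈0)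

  ∑-zero : ∀ {k} {f : Fin k → Carrier} → (∀ i → f i ≈ 0#) → sum f ≈ 0#
  ∑-zero {k} f≈0 = trans (sum-cong-≋ f≈0) (sum-replicate-zero k)

  ∑-single : ∀ {k} {f : Fin k → Carrier} i → (∀ j → j ≢ i → f j ≈ 0#) → sum f ≈ f i
  ∑-single {suc k} zero    f≈0 = +-≈0ʳ (∑-zero (λ j → f≈0 (suc j) λ ()))
  ∑-single {suc k} (suc i) f≈0 =
    trans (+-≈0ˡ (f≈0 zero λ ())) (∑-single i (λ j j≢i → f≈0 (suc j) (λ eq → j≢i (Fin.suc-injective eq))))

  natR-+ : ∀ x y → natR R (x ℕ.+ y) ≈ natR R x + natR R y
  natR-+ zero    y = sym (+-identityˡ _)
  natR-+ (suc x) y = trans (+-congˡ (natR-+ x y)) (sym (+-assoc _ _ _))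

  ∑-𝟙 : ∀ {k} (S : Subset k) → sum (λ i → 𝟙 (lookup S i)) ≈ natR R ∣ S ∣
  ∑-𝟙 []            = refl
  ∑-𝟙 (inside ∷ S)  = +-congˡ (∑-𝟙 S)
  ∑-𝟙 (outside ∷ S) = trans (+-identityˡ _) (∑-𝟙 S)

  ∑-𝟙-not : ∀ {k} (S : Subset k) → sum (λ i → 𝟙 (not (lookup S i))) ≈ natR R (k ∸ ∣ S ∣)
  ∑-𝟙-not []            = refl
  ∑-𝟙-not (inside ∷ S)  = trans (+-identityˡ _) (∑-𝟙-not S)
  ∑-𝟙-not {suc k} (outside ∷ S) =
    trans (+-congˡ (∑-𝟙-not S)) (reflexive (≡.cong (natR R) (≡.sym (ℕ.+-∸-assoc 1 (∣p∣≤n S)))))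

module Kronecker {c ℓ a} (R : CommutativeRing c ℓ) {A : Set a} (_≟_ : DecidableEquality A) where
  open CommutativeRing R hiding (zero)
  open RingLemmas R

  δ : A → A → Carrier
  δ x y = 𝟙 (does (x ≟ y))

  δ-refl : ∀ x → δ x x ≈ 1#
  δ-refl x = reflexive (≡.cong 𝟙 (dec-true (x ≟ x) ≡.refl))

  δ-≢ : ∀ {x y} → x ≢ y → δ x y ≈ 0#
  δ-≢ {x} {y} x≢y = reflexive (≡.cong 𝟙 (dec-false (x ≟ y) x≢y))

  δ-⇔ : ∀ {x y x′ y′} → (x ≡ y) ⇔ (x′ ≡ y′) → δ x y ≈ δ x′ y′
  δ-⇔ {x} {y} {x′} {y′} eq = reflexive (≡.cong 𝟙 (does-⇔ eq (x ≟ y) (x′ ≟ y′)))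

module LevelSums (n k : ℕ) where
  open import Data.Nat.Tactic.RingSolver using (solve-∀)
  open import Data.Nat.Base using (_+_; _*_)
  open ≡ using (cong; cong₂; trans; sym)

  -- The commutator of down with upᵐ⁺¹ on level k sums |S| and n − |S| over the levels k, …, k + m.
  levelSum : ℕ → ℕ
  levelSum zero    = k
  levelSum (suc m) = levelSum m + (suc m + k)

  coLevelSum : ℕ → ℕ
  coLevelSum zero    = n ∸ k
  coLevelSum (suc m) = coLevelSum m + (n ∸ (suc m + k))

  ∸-≡ : ∀ {x} j y → x ≡ j + y → x ∸ j ≡ y
  ∸-≡ j y eq = trans (cong (_∸ j) eq) (ℕ.m+n∸m≡n j y)

  coLevelSum≡levelSum+ : ∀ m M → n ≡ k + k + m + suc M → coLevelSum m ≡ levelSum m + suc m * suc M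
  coLevelSum≡levelSum+ zero M eq = trans (∸-≡ k (k + suc M) (trans eq (shuffle k M))) (unit-factor k M)
    where
    shuffle : ∀ k M → k + k + 0 + suc M ≡ k + (k + suc M)
    shuffle = solve-∀
    unit-factor : ∀ k M → k + suc M ≡ k + 1 * suc M
    unit-factor = solve-∀
  coLevelSum≡levelSum+ (suc m) M eq = trans (cong₂ _+_ ih last) (regroup (levelSum m) m k M)
    where
    shift : ∀ k m M → k + k + suc m + suc M ≡ k + k + m + suc (suc M)
    shift = solve-∀
    ih : coLevelSum m ≡ levelSum m + suc m * suc (suc M)
    ih = coLevelSum≡levelSum+ m (suc M) (trans eq (shift k m M))
    split : ∀ k m M → k + k + suc m + suc M ≡ (suc m + k) + (k + suc M)
    split = solve-∀
    last : n ∸ (suc m + k) ≡ k + suc M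
    last = ∸-≡ (suc m + k) (k + suc M) (trans eq (split k m M))
    regroup : ∀ x m k M → x + suc m * suc (suc M) + (k + suc M) ≡ x + (suc m + k) + suc (suc m) * suc M
    regroup = solve-∀

  gap : ∀ m → k + k + suc m ≤ n → n ≡ k + k + m + suc (n ∸ (k + k + suc m))
  gap m le = trans (sym (ℕ.m+[n∸m]≡n le)) (shift (k + k) m (n ∸ (k + k + suc m)))
    where
    shift : ∀ x m y → x + suc m + y ≡ x + m + suc y
    shift = solve-∀

module BooleanCube {c ℓ} (R : CommutativeRing c ℓ) (n : ℕ) where
  open CommutativeRing R hiding (zero)
  open import Algebra.Properties.Semiring.Sum semiring
    using (sum; sum-syntax; sum-cong-≋; ∑-distrib-+; ∑-comm; *-distribˡ-sum; *-distribʳ-sum)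
  open import Algebra.Properties.CommutativeSemigroup *-commutativeSemigroup using (x∙yz≈y∙xz)
  open import Algebra.Solver.Ring.NaturalCoefficients.Default commutativeSemiring
    using (solve; _:=_; _:+_; _:*_)
  open import Relation.Binary.Reasoning.Setoid setoid
  open RingLemmas R
  open Subsets

  -- g : Fn stands for the multilinear polynomial ∑_S g S · ∏_{i ∈ S} x_i.
  Fn : Set c
  Fn = Subset n → Carrier

  infix 4 _≐_
  _≐_ : Fn → Fn → Set ℓ
  f ≐ g = ∀ S → f S ≈ g S

  0F : Fn
  0F _ = 0#

  -- Multiplication by x_i and by L = 1 + x_1 + … + x_n, modulo x_i² = x_i.
  mulX : Fin n → Fn → Fn
  mulX i g S = 𝟙 (lookup S i) * (g S + g (S [ i ]≔ outside))

  mulL : Fn → Fn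
  mulL g S = (∑[ i < n ] mulX i g S) + g S

  up : Fn → Fn
  up g S = ∑[ i < n ] (𝟙 (lookup S i) * g (S [ i ]≔ outside))

  down : Fn → Fn
  down g S = ∑[ i < n ] (𝟙 (not (lookup S i)) * g (S [ i ]≔ inside))

  up^ : ℕ → Fn → Fn
  up^ zero    g = g
  up^ (suc m) g = up (up^ m g)

  Homogeneous : ℕ → Fn → Set ℓ
  Homogeneous k g = ∀ S → ∣ S ∣ ≢ k → g S ≈ 0#

  DegreeAtMost : ℕ → Fn → Set ℓ
  DegreeAtMost t g = ∀ S → t < ∣ S ∣ → g S ≈ 0#

  component : ℕ → Fn → Fn
  component k g S = 𝟙 (does (∣ S ∣ ℕ.≟ k)) * g S

  mulX-cong : ∀ i {f g} → f ≐ g → mulX i f ≐ mulX i g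
  mulX-cong i f≐g S = *-congˡ (+-cong (f≐g S) (f≐g (S [ i ]≔ outside)))

  mulL-cong : ∀ {f g} → f ≐ g → mulL f ≐ mulL g
  mulL-cong f≐g S = +-cong (sum-cong-≋ (λ i → mulX-cong i f≐g S)) (f≐g S)

  mulL-zero : ∀ {f} → f ≐ 0F → mulL f ≐ 0F
  mulL-zero f≐0 S =
    ≈0+≈0 (∑-zero (λ i → *-≈0ʳ (≈0+≈0 (f≐0 S) (f≐0 (S [ i ]≔ outside))))) (f≐0 S)

  mulL-linear : ∀ a f b g → mulL (λ T → a * f T + b * g T) ≐ λ S → a * mulL f S + b * mulL g S
  mulL-linear a f b g S = begin
    (∑[ i < n ] (𝟙 (lookup S i) * ((a * f S + b * g S) + (a * f (S′ i) + b * g (S′ i))))) + (a * f S + b * g S)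
      ≈⟨ +-congʳ (sum-cong-≋ (λ i → distribute (𝟙 (lookup S i)) a b (f S) (g S) (f (S′ i)) (g (S′ i)))) ⟩
    (∑[ i < n ] (a * mulX i f S + b * mulX i g S)) + (a * f S + b * g S)
      ≈⟨ +-congʳ (trans (∑-distrib-+ (λ i → a * mulX i f S) (λ i → b * mulX i g S))
                          (+-cong (sym (*-distribˡ-sum a (λ i → mulX i f S))) (sym (*-distribˡ-sum b (λ i → mulX i g S))))) ⟩
    (a * (∑[ i < n ] mulX i f S) + b * (∑[ i < n ] mulX i g S)) + (a * f S + b * g S)
      ≈⟨ regroup a b (sum (λ i → mulX i f S)) (sum (λ i → mulX i g S)) (f S) (g S) ⟩
    a * mulL f S + b * mulL g S ∎
    where
    S′ : Fin n → Subset n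
    S′ i = S [ i ]≔ outside
    distribute : ∀ e a b x y z w → e * ((a * x + b * y) + (a * z + b * w)) ≈ a * (e * (x + z)) + b * (e * (y + w))
    distribute = solve 7 (λ e a b x y z w → e :* ((a :* x :+ b :* y) :+ (a :* z :+ b :* w))
                                            := a :* (e :* (x :+ z)) :+ b :* (e :* (y :+ w))) refl
    regroup : ∀ a b F G x y → (a * F + b * G) + (a * x + b * y) ≈ a * (F + x) + b * (G + y)
    regroup = solve 6 (λ a b F G x y → (a :* F :+ b :* G) :+ (a :* x :+ b :* y) := a :* (F :+ x) :+ b :* (G :+ y)) refl

  mulX-comm : ∀ i j g → mulX i (mulX j g) ≐ mulX j (mulX i g)
  mulX-comm i j g S with i Fin.≟ j
  ... | yes ≡.refl = refl
  ... | no i≢j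
    rewrite lookup-[j]≔ S j i outside (λ j≡i → i≢j (≡.sym j≡i)) | lookup-[j]≔ S i j outside i≢j
          | []≔-commutes {x = outside} {y = outside} S i j i≢j =
    swap (𝟙 (lookup S i)) (𝟙 (lookup S j)) (g S) (g (S [ j ]≔ outside)) (g (S [ i ]≔ outside))
         (g ((S [ j ]≔ outside) [ i ]≔ outside))
    where
    swap : ∀ a b x y z w → a * (b * (x + y) + b * (z + w)) ≈ b * (a * (x + z) + a * (y + w))
    swap = solve 6 (λ a b x y z w → a :* (b :* (x :+ y) :+ b :* (z :+ w)) := b :* (a :* (x :+ z) :+ a :* (y :+ w))) refl

  mulX-mulL : ∀ i g → mulX i (mulL g) ≐ mulL (mulX i g)
  mulX-mulL i g S = begin
    𝟙 (lookup S i) * ((ΣX S + g S) + (ΣX S′ + g S′))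
      ≈⟨ regroup (𝟙 (lookup S i)) (ΣX S) (g S) (ΣX S′) (g S′) ⟩
    𝟙 (lookup S i) * (ΣX S + ΣX S′) + mulX i g S
      ≈⟨ +-congʳ (trans (*-congˡ (sym (∑-distrib-+ (λ j → mulX j g S) (λ j → mulX j g S′))))
                        (*-distribˡ-sum (𝟙 (lookup S i)) (λ j → mulX j g S + mulX j g S′))) ⟩
    (∑[ j < n ] mulX i (mulX j g) S) + mulX i g S
      ≈⟨ +-congʳ (sum-cong-≋ (λ j → mulX-comm i j g S)) ⟩
    mulL (mulX i g) S ∎
    where
    S′ : Subset n
    S′ = S [ i ]≔ outside
    ΣX : Subset n → Carrier
    ΣX T = ∑[ j < n ] mulX j g T
    regroup : ∀ a F x G y → a * ((F + x) + (G + y)) ≈ a * (F + G) + a * (x + y)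
    regroup = solve 5 (λ a F x G y → a :* ((F :+ x) :+ (G :+ y)) := a :* (F :+ G) :+ a :* (x :+ y)) refl

  up-cong : ∀ {f g} → f ≐ g → up f ≐ up g
  up-cong f≐g S = sum-cong-≋ (λ i → *-congˡ (f≐g (S [ i ]≔ outside)))

  up-zero : ∀ {f} → f ≐ 0F → up f ≐ 0F
  up-zero f≐0 S = ∑-zero (λ i → *-≈0ʳ (f≐0 (S [ i ]≔ outside)))

  up^-zero : ∀ m {f} → f ≐ 0F → up^ m f ≐ 0F
  up^-zero zero    f≐0 = f≐0
  up^-zero (suc m) f≐0 = up-zero (up^-zero m f≐0)

  down-zero : ∀ {f} → f ≐ 0F → down f ≐ 0F
  down-zero f≐0 S = ∑-zero (λ i → *-≈0ʳ (f≐0 (S [ i ]≔ inside)))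

  up-affine : ∀ f a u → (λ S → up f S + a * up u S) ≐ up (λ T → f T + a * u T)
  up-affine f a u S = begin
    up f S + a * up u S
      ≈⟨ +-congˡ (*-distribˡ-sum a (λ i → 𝟙 (lookup S i) * u (S [ i ]≔ outside))) ⟩
    up f S + ∑[ i < n ] (a * (𝟙 (lookup S i) * u (S [ i ]≔ outside)))
      ≈⟨ sym (∑-distrib-+ (λ i → 𝟙 (lookup S i) * f (S [ i ]≔ outside))
                          (λ i → a * (𝟙 (lookup S i) * u (S [ i ]≔ outside)))) ⟩
    ∑[ i < n ] (𝟙 (lookup S i) * f (S [ i ]≔ outside) + a * (𝟙 (lookup S i) * u (S [ i ]≔ outside)))
      ≈⟨ sum-cong-≋ (λ i → trans (+-congˡ (x∙yz≈y∙xz a (𝟙 (lookup S i)) _))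
                                 (sym (distribˡ (𝟙 (lookup S i)) _ _))) ⟩
    up (λ T → f T + a * u T) S ∎

  up-preserves-affine : ∀ f w u a b → (λ T → f T + a * u T) ≐ (λ T → w T + b * u T) →
                        (λ S → up f S + a * up u S) ≐ (λ S → up w S + b * up u S)
  up-preserves-affine f w u a b eq S =
    trans (up-affine f a u S) (trans (up-cong eq S) (sym (up-affine w b u S)))

  up-local : ∀ f g S → (∀ i → lookup S i ≡ inside → f (S [ i ]≔ outside) ≈ g (S [ i ]≔ outside)) →
             up f S ≈ up g S
  up-local f g S eq = sum-cong-≋ (λ i → 𝟙-guard (lookup S i) (eq i))

  open Kronecker R (≡-dec {n = n} Bool._≟_) public using (δ; δ-refl; δ-≢; δ-⇔)

  δ-insert : ∀ T i S → δ (T [ i ]≔ inside) S ≈ 𝟙 (lookup S i) * (δ T S + δ T (S [ i ]≔ outside))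
  δ-insert T i S with lookup S i in S[i] | lookup T i in T[i]
  ... | outside | _ = trans (δ-≢ (differ-at (T [ i ]≔ inside) S i (lookup-[i]≔ T i inside) S[i])) (sym (zeroˡ _))
  ... | inside | inside = begin
    δ (T [ i ]≔ inside) S             ≡⟨ ≡.cong (λ U → δ U S) ([i]≔-lookup T i inside T[i]) ⟩
    δ T S                             ≈⟨ sym (+-≈0ʳ (δ-≢ (differ-at T (S [ i ]≔ outside) i T[i] (lookup-[i]≔ S i outside)))) ⟩
    δ T S + δ T (S [ i ]≔ outside)    ≈⟨ sym (*-identityˡ _) ⟩
    1# * (δ T S + δ T (S [ i ]≔ outside)) ∎
  ... | inside | outside = begin
    δ (T [ i ]≔ inside) S             ≈⟨ δ-⇔ (mk⇔ remove insert) ⟩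
    δ T (S [ i ]≔ outside)            ≈⟨ sym (+-≈0ˡ (δ-≢ (≡.≢-sym (differ-at S T i S[i] T[i])))) ⟩
    δ T S + δ T (S [ i ]≔ outside)    ≈⟨ sym (*-identityˡ _) ⟩
    1# * (δ T S + δ T (S [ i ]≔ outside)) ∎
    where
    remove : T [ i ]≔ inside ≡ S → T ≡ S [ i ]≔ outside
    remove eq = ≡.trans (≡.sym ([i]≔-lookup T i outside T[i]))
                        (≡.trans (≡.sym ([]≔-idempotent T i)) (≡.cong (_[ i ]≔ outside) eq))
    insert : T ≡ S [ i ]≔ outside → T [ i ]≔ inside ≡ S
    insert eq = ≡.trans (≡.cong (_[ i ]≔ inside) eq)
                        (≡.trans ([]≔-idempotent S i) ([i]≔-lookup S i inside S[i]))

  up-homogeneous : ∀ k g → Homogeneous k g → Homogeneous (suc k) (up g)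
  up-homogeneous k g hom S ∣S∣≢1+k = ∑-zero summand
    where
    summand : ∀ i → 𝟙 (lookup S i) * g (S [ i ]≔ outside) ≈ 0#
    summand i with lookup S i in S∋i
    ... | inside  = *-≈0ʳ (hom _ λ eq → ∣S∣≢1+k (≡.trans (≡.sym (∣p[i]≔outside∣ S i S∋i)) (≡.cong suc eq)))
    ... | outside = zeroˡ _

  up^-homogeneous : ∀ k g → Homogeneous k g → ∀ m → Homogeneous (m ℕ.+ k) (up^ m g)
  up^-homogeneous k g hom zero    = hom
  up^-homogeneous k g hom (suc m) = up-homogeneous (m ℕ.+ k) (up^ m g) (up^-homogeneous k g hom m)

  down-homogeneous : ∀ k g → Homogeneous (suc k) g → Homogeneous k (down g)
  down-homogeneous k g hom S ∣S∣≢k = ∑-zero summand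
    where
    summand : ∀ i → 𝟙 (not (lookup S i)) * g (S [ i ]≔ inside) ≈ 0#
    summand i with lookup S i in S∌i
    ... | outside = *-≈0ʳ (hom _ λ eq → ∣S∣≢k (ℕ.suc-injective (≡.trans (≡.sym (∣p[i]≔inside∣ S i S∌i)) eq)))
    ... | inside  = zeroˡ _

  down-homogeneous₀ : ∀ g → Homogeneous 0 g → down g ≐ 0F
  down-homogeneous₀ g hom S = ∑-zero summand
    where
    summand : ∀ i → 𝟙 (not (lookup S i)) * g (S [ i ]≔ inside) ≈ 0#
    summand i with lookup S i in S∌i
    ... | outside = *-≈0ʳ (hom _ λ eq → ℕ.1+n≢0 (≡.trans (≡.sym (∣p[i]≔inside∣ S i S∌i)) eq))
    ... | inside  = zeroˡ _

  mulL-degree : ∀ t g → DegreeAtMost t g → DegreeAtMost (suc t) (mulL g)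
  mulL-degree t g deg S 1+t<∣S∣ = ≈0+≈0 (∑-zero summand) (deg S t<∣S∣)
    where
    t<∣S∣ : t < ∣ S ∣
    t<∣S∣ = ℕ.<-trans (ℕ.n<1+n t) 1+t<∣S∣
    summand : ∀ i → mulX i g S ≈ 0#
    summand i with lookup S i in S∋i
    ... | inside  = *-≈0ʳ (≈0+≈0 (deg S t<∣S∣)
                                 (deg _ (ℕ.≤-pred (ℕ.≤-trans 1+t<∣S∣ (ℕ.≤-reflexive (≡.sym (∣p[i]≔outside∣ S i S∋i)))))))
    ... | outside = zeroˡ _

  mulL-top : ∀ t g → DegreeAtMost t g → ∀ S → ∣ S ∣ ≡ suc t → mulL g S ≈ up g S
  mulL-top t g deg S ∣S∣≡1+t =
    trans (+-≈0ʳ (deg S t<∣S∣)) (sum-cong-≋ {x = λ i → mulX i g S} (λ i → *-congˡ (+-≈0ˡ (deg S t<∣S∣))))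
    where
    t<∣S∣ : t < ∣ S ∣
    t<∣S∣ = ℕ.≤-reflexive (≡.sym ∣S∣≡1+t)

  component-homogeneous : ∀ k g → Homogeneous k (component k g)
  component-homogeneous k g S ∣S∣≢k =
    trans (*-congʳ (reflexive (≡.cong 𝟙 (dec-false (∣ S ∣ ℕ.≟ k) ∣S∣≢k)))) (zeroˡ _)

  component-≡ : ∀ k g S → ∣ S ∣ ≡ k → component k g S ≈ g S
  component-≡ k g S ∣S∣≡k =
    trans (*-congʳ (reflexive (≡.cong 𝟙 (dec-true (∣ S ∣ ℕ.≟ k) ∣S∣≡k)))) (*-identityˡ _)

  -- Only the summand j = i undoes the toggle at i, and it returns g S.
  ∑-after-toggle : ∀ (g : Fn) (side : Bool → Bool) S i v w → lookup S i ≡ v → side w ≡ true → side v ≡ false →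
    ∑[ j < n ] (𝟙 (side (lookup (S [ i ]≔ w) j)) * g ((S [ i ]≔ w) [ j ]≔ v))
      ≈ g S + ∑[ j < n ] (𝟙 (side (lookup S j)) * g ((S [ i ]≔ w) [ j ]≔ v))
  ∑-after-toggle g side S i v w S[i]≡v side-w side-v = begin
    ∑[ j < n ] (𝟙 (side (lookup (S [ i ]≔ w) j)) * g ((S [ i ]≔ w) [ j ]≔ v))
      ≈⟨ sum-cong-≋ split ⟩
    ∑[ j < n ] (𝟙 (does (j Fin.≟ i)) * g S + 𝟙 (side (lookup S j)) * g ((S [ i ]≔ w) [ j ]≔ v))
      ≈⟨ ∑-distrib-+ (λ j → 𝟙 (does (j Fin.≟ i)) * g S) _ ⟩
    ∑[ j < n ] (𝟙 (does (j Fin.≟ i)) * g S) + ∑[ j < n ] (𝟙 (side (lookup S j)) * g ((S [ i ]≔ w) [ j ]≔ v))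
      ≈⟨ +-congʳ (trans (∑-single i λ j j≢i → trans (*-congʳ (reflexive (≡.cong 𝟙 (dec-false (j Fin.≟ i) j≢i)))) (zeroˡ _))
                        (trans (*-congʳ (reflexive (≡.cong 𝟙 (dec-true (i Fin.≟ i) ≡.refl)))) (*-identityˡ _))) ⟩
    g S + ∑[ j < n ] (𝟙 (side (lookup S j)) * g ((S [ i ]≔ w) [ j ]≔ v)) ∎
    where
    split : ∀ j → 𝟙 (side (lookup (S [ i ]≔ w) j)) * g ((S [ i ]≔ w) [ j ]≔ v)
                  ≈ 𝟙 (does (j Fin.≟ i)) * g S + 𝟙 (side (lookup S j)) * g ((S [ i ]≔ w) [ j ]≔ v)
    split j with j Fin.≟ i
    ... | yes ≡.refl rewrite lookup-[i]≔ S j w | side-w | []≔-idempotent {x = w} {y = v} S j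
                           | [i]≔-lookup S j v S[i]≡v | ≡.sym S[i]≡v | side-v = sym (+-≈0ʳ (zeroˡ _))
    ... | no j≢i rewrite lookup-[j]≔ S j i w j≢i = sym (+-≈0ˡ (zeroˡ _))

  down-up-expand : ∀ g S → down (up g) S ≈ natR R (n ∸ ∣ S ∣) * g S
    + ∑[ i < n ] ∑[ j < n ] (𝟙 (not (lookup S i)) * (𝟙 (lookup S j) * g ((S [ i ]≔ inside) [ j ]≔ outside)))
  down-up-expand g S = begin
    down (up g) S
      ≈⟨ sum-cong-≋ (λ i → 𝟙-guard (not (lookup S i)) λ S∌i →
           ∑-after-toggle g (λ b → b) S i outside inside (not-true S∌i) ≡.refl ≡.refl) ⟩
    ∑[ i < n ] (𝟙 (not (lookup S i)) * (g S + ∑[ j < n ] Y i j))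
      ≈⟨ sum-cong-≋ (λ i → trans (distribˡ (𝟙 (not (lookup S i))) (g S) _)
                                 (+-congˡ (*-distribˡ-sum (𝟙 (not (lookup S i))) (Y i)))) ⟩
    ∑[ i < n ] (𝟙 (not (lookup S i)) * g S + ∑[ j < n ] (𝟙 (not (lookup S i)) * Y i j))
      ≈⟨ ∑-distrib-+ (λ i → 𝟙 (not (lookup S i)) * g S) _ ⟩
    ∑[ i < n ] (𝟙 (not (lookup S i)) * g S) + _
      ≈⟨ +-congʳ (trans (sym (*-distribʳ-sum (g S) (λ i → 𝟙 (not (lookup S i))))) (*-congʳ (∑-𝟙-not S))) ⟩
    natR R (n ∸ ∣ S ∣) * g S + _ ∎
    where
    not-true : ∀ {b} → not b ≡ true → b ≡ outside
    not-true {false} _ = ≡.refl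
    Y : Fin n → Fin n → Carrier
    Y i j = 𝟙 (lookup S j) * g ((S [ i ]≔ inside) [ j ]≔ outside)

  up-down-expand : ∀ g S → up (down g) S ≈ natR R ∣ S ∣ * g S
    + ∑[ j < n ] ∑[ i < n ] (𝟙 (lookup S j) * (𝟙 (not (lookup S i)) * g ((S [ j ]≔ outside) [ i ]≔ inside)))
  up-down-expand g S = begin
    up (down g) S
      ≈⟨ sum-cong-≋ (λ j → 𝟙-guard (lookup S j) λ S∋j →
           ∑-after-toggle g not S j inside outside S∋j ≡.refl ≡.refl) ⟩
    ∑[ j < n ] (𝟙 (lookup S j) * (g S + ∑[ i < n ] Y j i))
      ≈⟨ sum-cong-≋ (λ j → trans (distribˡ (𝟙 (lookup S j)) (g S) _)
                                 (+-congˡ (*-distribˡ-sum (𝟙 (lookup S j)) (Y j)))) ⟩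
    ∑[ j < n ] (𝟙 (lookup S j) * g S + ∑[ i < n ] (𝟙 (lookup S j) * Y j i))
      ≈⟨ ∑-distrib-+ (λ j → 𝟙 (lookup S j) * g S) _ ⟩
    ∑[ j < n ] (𝟙 (lookup S j) * g S) + _
      ≈⟨ +-congʳ (trans (sym (*-distribʳ-sum (g S) (λ j → 𝟙 (lookup S j)))) (*-congʳ (∑-𝟙 S))) ⟩
    natR R ∣ S ∣ * g S + _ ∎
    where
    Y : Fin n → Fin n → Carrier
    Y j i = 𝟙 (not (lookup S i)) * g ((S [ j ]≔ outside) [ i ]≔ inside)

  add-remove-swap : ∀ (g : Fn) S i j →
    𝟙 (not (lookup S i)) * (𝟙 (lookup S j) * g ((S [ i ]≔ inside) [ j ]≔ outside))
      ≈ 𝟙 (lookup S j) * (𝟙 (not (lookup S i)) * g ((S [ j ]≔ outside) [ i ]≔ inside))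
  add-remove-swap g S i j with lookup S i in S[i] | lookup S j in S[j]
  ... | inside  | _       = trans (zeroˡ _) (sym (*-≈0ʳ (zeroˡ _)))
  ... | outside | outside = trans (*-≈0ʳ (zeroˡ _)) (sym (zeroˡ _))
  ... | outside | inside  =
    trans (*-congˡ (*-congˡ (reflexive (≡.cong g ([]≔-commutes S i j i≢j))))) (x∙yz≈y∙xz _ _ _)
    where
    i≢j : i ≢ j
    i≢j ≡.refl with ≡.trans (≡.sym S[i]) S[j]
    ... | ()

  -- The sl₂ relation [down, up] = n − 2|S|, written without subtraction.
  down-up-commutator : ∀ g S → down (up g) S + natR R ∣ S ∣ * g S ≈ up (down g) S + natR R (n ∸ ∣ S ∣) * g S
  down-up-commutator g S = begin
    down (up g) S + natR R ∣ S ∣ * g S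
      ≈⟨ +-congʳ (down-up-expand g S) ⟩
    (natR R (n ∸ ∣ S ∣) * g S + ∑[ i < n ] ∑[ j < n ] A i j) + natR R ∣ S ∣ * g S
      ≈⟨ +-congʳ (+-congˡ (trans (∑-comm A) (sum-cong-≋ λ j → sum-cong-≋ λ i → add-remove-swap g S i j))) ⟩
    (natR R (n ∸ ∣ S ∣) * g S + C) + natR R ∣ S ∣ * g S
      ≈⟨ exchange (natR R (n ∸ ∣ S ∣) * g S) C (natR R ∣ S ∣ * g S) ⟩
    (natR R ∣ S ∣ * g S + C) + natR R (n ∸ ∣ S ∣) * g S
      ≈⟨ +-congʳ (sym (up-down-expand g S)) ⟩
    up (down g) S + natR R (n ∸ ∣ S ∣) * g S ∎
    where
    A : Fin n → Fin n → Carrier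
    A i j = 𝟙 (not (lookup S i)) * (𝟙 (lookup S j) * g ((S [ i ]≔ inside) [ j ]≔ outside))
    C : Carrier
    C = ∑[ j < n ] ∑[ i < n ] (𝟙 (lookup S j) * (𝟙 (not (lookup S i)) * g ((S [ j ]≔ outside) [ i ]≔ inside)))
    exchange : ∀ a c b → (a + c) + b ≈ (b + c) + a
    exchange = solve 3 (λ a c b → (a :+ c) :+ b := (b :+ c) :+ a) refl

  down-up-commutator-homogeneous : ∀ k g → Homogeneous k g →
    (λ S → down (up g) S + natR R k * g S) ≐ (λ S → up (down g) S + natR R (n ∸ k) * g S)
  down-up-commutator-homogeneous k g hom S with ∣ S ∣ ℕ.≟ k
  ... | yes ≡.refl = down-up-commutator g S
  ... | no ∣S∣≢k = begin
    down (up g) S + natR R k * g S          ≈⟨ +-congˡ (*-≈0ʳ (hom S ∣S∣≢k)) ⟩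
    down (up g) S + 0#                      ≈⟨ +-congˡ (sym (*-≈0ʳ (hom S ∣S∣≢k))) ⟩
    down (up g) S + natR R ∣ S ∣ * g S      ≈⟨ down-up-commutator g S ⟩
    up (down g) S + natR R (n ∸ ∣ S ∣) * g S ≈⟨ +-congˡ (*-≈0ʳ (hom S ∣S∣≢k)) ⟩
    up (down g) S + 0#                      ≈⟨ +-congˡ (sym (*-≈0ʳ (hom S ∣S∣≢k))) ⟩
    up (down g) S + natR R (n ∸ k) * g S    ∎

  mulX-degree : ∀ t g i → DegreeAtMost t g → (∀ S → ∣ S ∣ ≡ t → g S ≈ 0#) → DegreeAtMost t (mulX i g)
  mulX-degree t g i deg level S t<∣S∣ with lookup S i in S∋i
  ... | outside = zeroˡ _
  ... | inside  = *-≈0ʳ (≈0+≈0 (deg S t<∣S∣) (above (S [ i ]≔ outside) t≤∣S′∣))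
    where
    t≤∣S′∣ : t ≤ ∣ S [ i ]≔ outside ∣
    t≤∣S′∣ = ℕ.≤-pred (ℕ.≤-trans t<∣S∣ (ℕ.≤-reflexive (≡.sym (∣p[i]≔outside∣ S i S∋i))))
    above : ∀ T → t ≤ ∣ T ∣ → g T ≈ 0#
    above T t≤∣T∣ with ∣ T ∣ ℕ.≟ t
    ... | yes ∣T∣≡t = level T ∣T∣≡t
    ... | no ∣T∣≢t  = deg T (ℕ.≤∧≢⇒< t≤∣T∣ (λ eq → ∣T∣≢t (≡.sym eq)))

  mulL^ : ℕ → Fn → Fn
  mulL^ zero    g = g
  mulL^ (suc m) g = mulL (mulL^ m g)

  mulL^-degree : ∀ m t g → DegreeAtMost t g → DegreeAtMost (m ℕ.+ t) (mulL^ m g)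
  mulL^-degree zero    t g deg = deg
  mulL^-degree (suc m) t g deg = mulL-degree (m ℕ.+ t) (mulL^ m g) (mulL^-degree m t g deg)

  mulL^-top : ∀ m t g → DegreeAtMost t g → ∀ S → ∣ S ∣ ≡ m ℕ.+ t → mulL^ m g S ≈ up^ m (component t g) S
  mulL^-top zero    t g deg S ∣S∣≡t = sym (component-≡ t g S ∣S∣≡t)
  mulL^-top (suc m) t g deg S ∣S∣≡1+m+t = begin
    mulL (mulL^ m g) S     ≈⟨ mulL-top (m ℕ.+ t) (mulL^ m g) (mulL^-degree m t g deg) S ∣S∣≡1+m+t ⟩
    up (mulL^ m g) S       ≈⟨ up-local (mulL^ m g) (up^ m (component t g)) S (λ i S∋i →
                                mulL^-top m t g deg _ (ℕ.suc-injective (≡.trans (∣p[i]≔outside∣ S i S∋i) ∣S∣≡1+m+t))) ⟩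
    up^ (suc m) (component t g) S ∎

  module UpInjective (torsionFree : TorsionFree R) where
    open import Algebra.Properties.Ring ring using (+-cancelˡ)

    module _ (k : ℕ) where
      open LevelSums n k

      down-up^-commutator : ∀ g → Homogeneous k g → ∀ m →
        (λ S → down (up^ (suc m) g) S + natR R (levelSum m) * up^ m g S)
          ≐ (λ S → up^ (suc m) (down g) S + natR R (coLevelSum m) * up^ m g S)
      down-up^-commutator g hom zero S = down-up-commutator-homogeneous k g hom S
      down-up^-commutator g hom (suc m) S = begin
        down (up h) S + natR R (levelSum m ℕ.+ (suc m ℕ.+ k)) * h S
          ≈⟨ +-congˡ (*-congʳ (natR-+ (levelSum m) _)) ⟩
        down (up h) S + (natR R (levelSum m) + natR R (suc m ℕ.+ k)) * h S
          ≈⟨ chain (down-up-commutator-homogeneous (suc m ℕ.+ k) h (up^-homogeneous k g hom (suc m)) S)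
                   (up-preserves-affine (down h) _ (up^ m g) _ _ (down-up^-commutator g hom m) S) ⟩
        up^ (suc (suc m)) (down g) S + (natR R (coLevelSum m) + natR R (n ∸ (suc m ℕ.+ k))) * h S
          ≈⟨ +-congˡ (*-congʳ (sym (natR-+ (coLevelSum m) _))) ⟩
        up^ (suc (suc m)) (down g) S + natR R (coLevelSum m ℕ.+ (n ∸ (suc m ℕ.+ k))) * h S ∎
        where
        h : Fn
        h = up^ (suc m) g
        chain : ∀ {P Q W A B c d x} → P + A * x ≈ Q + B * x → Q + c * x ≈ W + d * x →
                P + (c + A) * x ≈ W + (d + B) * x
        chain {P} {Q} {W} {A} {B} {c} {d} {x} e₁ e₂ = begin
          P + (c + A) * x     ≈⟨ move P c A x ⟩
          (P + A * x) + c * x ≈⟨ +-congʳ e₁ ⟩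
          (Q + B * x) + c * x ≈⟨ move′ Q B c x ⟩
          (Q + c * x) + B * x ≈⟨ +-congʳ e₂ ⟩
          (W + d * x) + B * x ≈⟨ collect W d B x ⟩
          W + (d + B) * x     ∎
          where
          move : ∀ P c A x → P + (c + A) * x ≈ (P + A * x) + c * x
          move = solve 4 (λ P c A x → P :+ (c :+ A) :* x := (P :+ A :* x) :+ c :* x) refl
          move′ : ∀ Q B c x → (Q + B * x) + c * x ≈ (Q + c * x) + B * x
          move′ = solve 4 (λ Q B c x → (Q :+ B :* x) :+ c :* x := (Q :+ c :* x) :+ B :* x) refl
          collect : ∀ W d B x → (W + d * x) + B * x ≈ W + (d + B) * x
          collect = solve 4 (λ W d B x → (W :+ d :* x) :+ B :* x := W :+ (d :+ B) :* x) refl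

    module Lowering (k m : ℕ) (g : Fn) (le : k ℕ.+ k ℕ.+ suc m ≤ n) (hom : Homogeneous k g)
                    (vanish : up^ (suc m) g ≐ 0F) where
      open LevelSums n k

      slack : ℕ
      slack = n ∸ (k ℕ.+ k ℕ.+ suc m)

      -- suc m * suc slack = (m + 1)(n − 2k − m) = coLevelSum m − levelSum m, a positive integer.
      relation : (λ S → up^ (suc m) (down g) S + natR R (suc m ℕ.* suc slack) * up^ m g S) ≐ 0F
      relation S = cancel (begin
        natR R (levelSum m) * up^ m g S
          ≈⟨ sym (+-≈0ˡ (down-zero vanish S)) ⟩
        down (up^ (suc m) g) S + natR R (levelSum m) * up^ m g S
          ≈⟨ down-up^-commutator k g hom m S ⟩
        up^ (suc m) (down g) S + natR R (coLevelSum m) * up^ m g S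
          ≈⟨ +-congˡ (*-congʳ (trans (reflexive (≡.cong (natR R) (coLevelSum≡levelSum+ m slack (gap m le))))
                                     (natR-+ (levelSum m) _))) ⟩
        up^ (suc m) (down g) S + (natR R (levelSum m) + natR R (suc m ℕ.* suc slack)) * up^ m g S
          ≈⟨ +-congˡ (distribʳ _ _ _) ⟩
        up^ (suc m) (down g) S + (natR R (levelSum m) * up^ m g S + natR R (suc m ℕ.* suc slack) * up^ m g S) ∎)
        where
        cancel : ∀ {x y z} → x ≈ y + (x + z) → y + z ≈ 0#
        cancel {x} {y} {z} eq = +-cancelˡ x (y + z) 0# (trans (swap x y z) (trans (sym eq) (sym (+-identityʳ x))))
          where
          swap : ∀ x y z → x + (y + z) ≈ y + (x + z)
          swap = solve 3 (λ x y z → x :+ (y :+ z) := y :+ (x :+ z)) refl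

      up^-down-vanishes : up^ (suc (suc m)) (down g) ≐ 0F
      up^-down-vanishes S = begin
        up^ (suc (suc m)) (down g) S
          ≈⟨ sym (+-≈0ʳ (*-≈0ʳ (vanish S))) ⟩
        up^ (suc (suc m)) (down g) S + natR R (suc m ℕ.* suc slack) * up (up^ m g) S
          ≈⟨ up-affine (up^ (suc m) (down g)) _ (up^ m g) S ⟩
        up (λ T → up^ (suc m) (down g) T + natR R (suc m ℕ.* suc slack) * up^ m g T) S
          ≈⟨ up-zero relation S ⟩
        0# ∎

      lower : down g ≐ 0F → up^ m g ≐ 0F
      lower down≐0 S = torsionFree (slack ℕ.+ m ℕ.* suc slack) (up^ m g S)
        (trans (sym (+-≈0ˡ (up^-zero (suc m) down≐0 S))) (relation S))

    up^-injective : ∀ k m g → k ℕ.+ k ℕ.+ m ≤ n → Homogeneous k g → up^ m g ≐ 0F → g ≐ 0F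
    up^-injective k zero g _ _ g≐0 = g≐0
    up^-injective zero (suc m) g le hom vanish =
      up^-injective 0 m g (ℕ.≤-trans (ℕ.n≤1+n m) le) hom (lower (down-homogeneous₀ g hom))
      where open Lowering 0 m g le hom vanish
    up^-injective (suc k) (suc m) g le hom vanish =
      up^-injective (suc k) m g (ℕ.≤-trans (ℕ.+-monoʳ-≤ (suc k ℕ.+ suc k) (ℕ.n≤1+n m)) le) hom
        (lower (up^-injective k (suc (suc m)) (down g) le′ (down-homogeneous k g hom) up^-down-vanishes))
      where
      open Lowering (suc k) m g le hom vanish
      le′ : k ℕ.+ k ℕ.+ suc (suc m) ≤ n
      le′ = ℕ.≤-trans (ℕ.≤-reflexive (shift k m)) (ℕ.≤-trans (ℕ.n≤1+n _) le)
        where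
        open import Data.Nat.Tactic.RingSolver using (solve-∀)
        shift : ∀ k m → k ℕ.+ k ℕ.+ suc (suc m) ≡ k ℕ.+ suc k ℕ.+ suc m
        shift = solve-∀

    level-vanishing : ∀ m t g → DegreeAtMost t g → (∀ S → ∣ S ∣ ≡ m ℕ.+ t → mulL^ m g S ≈ 0#) →
                      t ℕ.+ t ℕ.+ m ≤ n → ∀ S → ∣ S ∣ ≡ t → g S ≈ 0#
    level-vanishing m t g deg top le S ∣S∣≡t =
      trans (sym (component-≡ t g S ∣S∣≡t)) (up^-injective t m (component t g) le (component-homogeneous t g) vanish S)
      where
      vanish : up^ m (component t g) ≐ 0F
      vanish T with ∣ T ∣ ℕ.≟ m ℕ.+ t
      ... | yes ∣T∣≡m+t = trans (sym (mulL^-top m t g deg T ∣T∣≡m+t)) (top T ∣T∣≡m+t)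
      ... | no ∣T∣≢m+t  = up^-homogeneous t (component t g) (component-homogeneous t g) m T ∣T∣≢m+t

    mulL-injective : ∀ t g → DegreeAtMost t g → (∀ S → 1 ≤ ∣ S ∣ → mulL g S ≈ 0#) →
                     suc (t ℕ.+ t) ≤ n → g ≐ 0F
    mulL-injective zero g deg mulL≐0 le S with ∣ S ∣ ℕ.≟ 0
    ... | yes ∣S∣≡0 =
      level-vanishing 1 0 g deg (λ T ∣T∣≡1 → mulL≐0 T (ℕ.≤-reflexive (≡.sym ∣T∣≡1))) le S ∣S∣≡0
    ... | no ∣S∣≢0  = deg S (ℕ.n≢0⇒n>0 ∣S∣≢0)
    mulL-injective (suc t) g deg mulL≐0 le =
      mulL-injective t g degree-drop mulL≐0 (ℕ.≤-trans (s≤s (ℕ.+-mono-≤ (ℕ.n≤1+n t) (ℕ.n≤1+n t))) le)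
      where
      top : ∀ S → ∣ S ∣ ≡ suc t → g S ≈ 0#
      top = level-vanishing 1 (suc t) g deg
              (λ T ∣T∣≡2+t → mulL≐0 T (ℕ.≤-trans (s≤s z≤n) (ℕ.≤-reflexive (≡.sym ∣T∣≡2+t))))
              (ℕ.≤-trans (ℕ.≤-reflexive (ℕ.+-comm (suc t ℕ.+ suc t) 1)) le)
      degree-drop : DegreeAtMost t g
      degree-drop S t<∣S∣ with ∣ S ∣ ℕ.≟ suc t
      ... | yes ∣S∣≡1+t = top S ∣S∣≡1+t
      ... | no ∣S∣≢1+t  = deg S (ℕ.≤∧≢⇒< t<∣S∣ (λ eq → ∣S∣≢1+t (≡.sym eq)))

module Reduction {c ℓ} (R : CommutativeRing c ℓ) (n : ℕ) where
  open CommutativeRing R hiding (zero)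
  open import Algebra.Properties.Ring ring using (-1*x≈-x)
  open import Algebra.Properties.Semiring.Sum semiring using (sum-syntax; sum-cong-≋)
  open import Algebra.Properties.CommutativeSemigroup *-commutativeSemigroup using (x∙yz≈y∙xz)
  open import Algebra.Solver.Ring.NaturalCoefficients.Default commutativeSemiring
    using (solve; _:=_; _:+_; _:*_)
  open import Relation.Binary.Reasoning.Setoid setoid
  open import Data.List using (List; []; _∷_; _++_; map; foldr; deduplicate)
  import Data.List as List
  open import Data.List.Membership.Propositional using (_∈_)
  open import Data.List.Membership.Propositional.Properties using (∈-++⁺ˡ; ∈-++⁺ʳ; ∈-deduplicate⁺)
  open import Data.List.Relation.Unary.Any using (here; there)
  open import Data.List.Relation.Unary.All using (All; _∷_)
  import Data.List.Relation.Unary.All as All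
  open import Data.List.Relation.Unary.AllPairs using (_∷_)
  open import Data.List.Relation.Unary.Unique.Propositional using (Unique)
  open import Data.List.Relation.Unary.Unique.DecPropositional.Properties using (deduplicate-!)
  open PC R n
  open RingLemmas R
  open Monomials
  open BooleanCube R n

  _≟ₘ_ : DecidableEquality Monomial
  _≟ₘ_ = ≡-dec ℕ._≟_

  open Kronecker R _≟ₘ_ using () renaming (δ to δₘ; δ-refl to δₘ-refl; δ-≢ to δₘ-≢; δ-⇔ to δₘ-⇔)

  extend : (Monomial → Carrier) → Poly → Carrier
  extend φ []            = 0#
  extend φ ((a , m) ∷ p) = a * φ m + extend φ p

  extend-+P : ∀ φ p q → extend φ (p +P q) ≈ extend φ p + extend φ q
  extend-+P φ []            q = sym (+-identityˡ _)
  extend-+P φ ((a , m) ∷ p) q = trans (+-congˡ (extend-+P φ p q)) (sym (+-assoc _ _ _))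

  extend-scale : ∀ φ b p → extend φ (scale b p) ≈ b * extend φ p
  extend-scale φ b []            = sym (zeroʳ b)
  extend-scale φ b ((a , m) ∷ p) = trans (+-cong (*-assoc b a (φ m)) (extend-scale φ b p)) (sym (distribˡ b _ _))

  extend-cong : ∀ {φ ψ} p → (∀ m → φ m ≈ ψ m) → extend φ p ≈ extend ψ p
  extend-cong []            φ≈ψ = refl
  extend-cong ((a , m) ∷ p) φ≈ψ = +-cong (*-congˡ (φ≈ψ m)) (extend-cong p φ≈ψ)

  extend-+ : ∀ φ ψ p → extend (λ m → φ m + ψ m) p ≈ extend φ p + extend ψ p
  extend-+ φ ψ []            = sym (+-identityˡ 0#)
  extend-+ φ ψ ((a , m) ∷ p) = trans (+-cong (distribˡ a _ _) (extend-+ φ ψ p)) (exchange _ _ _ _)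
    where
    exchange : ∀ a b c d → (a + b) + (c + d) ≈ (a + c) + (b + d)
    exchange = solve 4 (λ a b c d → (a :+ b) :+ (c :+ d) := (a :+ c) :+ (b :+ d)) refl

  extend-* : ∀ b φ p → extend (λ m → b * φ m) p ≈ b * extend φ p
  extend-* b φ []            = sym (zeroʳ b)
  extend-* b φ ((a , m) ∷ p) = trans (+-cong (x∙yz≈y∙xz a b (φ m)) (extend-* b φ p)) (sym (distribˡ b _ _))

  extend-zero : ∀ {φ} p → (∀ m → φ m ≈ 0#) → extend φ p ≈ 0#
  extend-zero []            φ≈0 = refl
  extend-zero ((a , m) ∷ p) φ≈0 = ≈0+≈0 (*-≈0ʳ (φ≈0 m)) (extend-zero p φ≈0)

  extend-∑ : ∀ {k} (φ : Fin k → Monomial → Carrier) p →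
             extend (λ m → ∑[ i < k ] φ i m) p ≈ ∑[ i < k ] extend (φ i) p
  extend-∑ {zero}  φ p = extend-zero p (λ _ → refl)
  extend-∑ {suc k} φ p = trans (extend-+ _ _ p) (+-congˡ (extend-∑ (λ i → φ (suc i)) p))

  extend-*P : ∀ φ p q → extend φ (p *P q) ≈ extend (λ m → extend (λ m′ → φ (m ⊞ m′)) q) p
  extend-*P φ []            q = refl
  extend-*P φ ((a , m) ∷ p) q =
    trans (extend-+P φ (map (λ { (b , m′) → (a * b , m ⊞ m′) }) q) (p *P q)) (+-cong (row q) (extend-*P φ p q))
    where
    row : ∀ q → extend φ (map (λ { (b , m′) → (a * b , m ⊞ m′) }) q) ≈ a * extend (λ m′ → φ (m ⊞ m′)) q
    row []             = sym (zeroʳ a)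
    row ((b , m′) ∷ q) = trans (+-cong (*-assoc a b _) (row q)) (sym (distribˡ a _ _))

  extend-*var : ∀ φ p i → extend φ (p *P var i) ≈ extend (λ m → φ (m ⊞ unit n i)) p
  extend-*var φ p i = trans (extend-*P φ p (var i)) (extend-cong p (λ m → trans (+-identityʳ _) (*-identityˡ _)))

  extend-sumVars+1 : ∀ ψ → extend ψ sumVars+1 ≈ ∑[ i < n ] ψ (unit n i) + ψ (replicate n 0)
  extend-sumVars+1 ψ = go (λ i → i)
    where
    go : ∀ {k} (v : Fin k → Fin n) →
         extend ψ (foldr (λ i p → var i +P p) (constP 1#) (List.tabulate v)) ≈ ∑[ j < k ] ψ (unit n (v j)) + ψ (replicate n 0)
    go {zero}  v = trans (trans (+-identityʳ _) (*-identityˡ _)) (sym (+-identityˡ _))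
    go {suc k} v = trans (+-cong (*-identityˡ _) (go (λ j → v (suc j)))) (sym (+-assoc _ _ _))

  coeff-∷ : ∀ a m′ p m → coeff ((a , m′) ∷ p) m ≈ a * δₘ m′ m + coeff p m
  coeff-∷ a m′ p m with m′ ≟ₘ m
  ... | yes _ = +-congʳ (sym (*-identityʳ a))
  ... | no  _ = sym (+-≈0ˡ (zeroʳ a))

  coeff-as-extend : ∀ p m → coeff p m ≈ extend (λ m′ → δₘ m′ m) p
  coeff-as-extend []             m = refl
  coeff-as-extend ((a , m′) ∷ p) m = trans (coeff-∷ a m′ p m) (+-congˡ (coeff-as-extend p m))

  ∑ₗ : List Monomial → (Monomial → Carrier) → Carrier
  ∑ₗ ms f = foldr (λ m s → f m + s) 0# ms

  ∑ₗ-cong : ∀ ms {f g} → (∀ m → f m ≈ g m) → ∑ₗ ms f ≈ ∑ₗ ms g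
  ∑ₗ-cong []       f≈g = refl
  ∑ₗ-cong (m ∷ ms) f≈g = +-cong (f≈g m) (∑ₗ-cong ms f≈g)

  ∑ₗ-zero : ∀ ms {f} → (∀ m → f m ≈ 0#) → ∑ₗ ms f ≈ 0#
  ∑ₗ-zero []       f≈0 = refl
  ∑ₗ-zero (m ∷ ms) f≈0 = ≈0+≈0 (f≈0 m) (∑ₗ-zero ms f≈0)

  ∑ₗ-+ : ∀ ms f g → ∑ₗ ms (λ m → f m + g m) ≈ ∑ₗ ms f + ∑ₗ ms g
  ∑ₗ-+ []       f g = sym (+-identityˡ 0#)
  ∑ₗ-+ (m ∷ ms) f g = trans (+-congˡ (∑ₗ-+ ms f g)) (exchange _ _ _ _)
    where
    exchange : ∀ a b c d → (a + b) + (c + d) ≈ (a + c) + (b + d)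
    exchange = solve 4 (λ a b c d → (a :+ b) :+ (c :+ d) := (a :+ c) :+ (b :+ d)) refl

  ∑ₗ-* : ∀ ms a f → ∑ₗ ms (λ m → a * f m) ≈ a * ∑ₗ ms f
  ∑ₗ-* []       a f = sym (zeroʳ a)
  ∑ₗ-* (m ∷ ms) a f = trans (+-congˡ (∑ₗ-* ms a f)) (sym (distribˡ a _ _))

  ∑ₗ-δₘ-∉ : ∀ ms m₀ (ψ : Monomial → Carrier) → All (m₀ ≢_) ms → ∑ₗ ms (λ m → δₘ m₀ m * ψ m) ≈ 0#
  ∑ₗ-δₘ-∉ []       m₀ ψ All.[]         = refl
  ∑ₗ-δₘ-∉ (m ∷ ms) m₀ ψ (m₀≢m ∷ m₀∉ms) =
    ≈0+≈0 (trans (*-congʳ (δₘ-≢ m₀≢m)) (zeroˡ _)) (∑ₗ-δₘ-∉ ms m₀ ψ m₀∉ms)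

  ∑ₗ-δₘ : ∀ ms m₀ (ψ : Monomial → Carrier) → Unique ms → m₀ ∈ ms → ∑ₗ ms (λ m → δₘ m₀ m * ψ m) ≈ ψ m₀
  ∑ₗ-δₘ (m ∷ ms) m₀ ψ (m∉ms ∷ _) (here ≡.refl) =
    trans (+-cong (trans (*-congʳ (δₘ-refl m₀)) (*-identityˡ _)) (∑ₗ-δₘ-∉ ms m₀ ψ m∉ms)) (+-identityʳ _)
  ∑ₗ-δₘ (m ∷ ms) m₀ ψ (m∉ms ∷ unique) (there m₀∈ms) =
    trans (+-≈0ˡ (trans (*-congʳ (δₘ-≢ m₀≢m)) (zeroˡ _))) (∑ₗ-δₘ ms m₀ ψ unique m₀∈ms)
    where
    m₀≢m : m₀ ≢ m
    m₀≢m eq = All.lookup m∉ms m₀∈ms (≡.sym eq)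

  monomials : Poly → List Monomial
  monomials = map proj₂

  extend-via-coeff : ∀ φ p ms → Unique ms → (∀ {m} → m ∈ monomials p → m ∈ ms) →
                     extend φ p ≈ ∑ₗ ms (λ m → coeff p m * φ m)
  extend-via-coeff φ []             ms _      _  = sym (∑ₗ-zero ms (λ m → zeroˡ _))
  extend-via-coeff φ ((a , m₀) ∷ p) ms unique ⊆ms = begin
    a * φ m₀ + extend φ p
      ≈⟨ +-cong (*-congˡ (sym (∑ₗ-δₘ ms m₀ φ unique (⊆ms (here ≡.refl)))))
                (extend-via-coeff φ p ms unique (λ m∈p → ⊆ms (there m∈p))) ⟩
    a * ∑ₗ ms (λ m → δₘ m₀ m * φ m) + ∑ₗ ms (λ m → coeff p m * φ m)
      ≈⟨ +-congʳ (sym (∑ₗ-* ms a _)) ⟩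
    ∑ₗ ms (λ m → a * (δₘ m₀ m * φ m)) + ∑ₗ ms (λ m → coeff p m * φ m)
      ≈⟨ sym (∑ₗ-+ ms _ _) ⟩
    ∑ₗ ms (λ m → a * (δₘ m₀ m * φ m) + coeff p m * φ m)
      ≈⟨ ∑ₗ-cong ms (λ m → trans (factor a (δₘ m₀ m) (φ m) (coeff p m)) (*-congʳ (sym (coeff-∷ a m₀ p m)))) ⟩
    ∑ₗ ms (λ m → coeff ((a , m₀) ∷ p) m * φ m) ∎
    where
    factor : ∀ a x y z → a * (x * y) + z * y ≈ (a * x + z) * y
    factor = solve 4 (λ a x y z → a :* (x :* y) :+ z :* y := (a :* x :+ z) :* y) refl

  extend-≈P : ∀ φ p q → p ≈P q → extend φ p ≈ extend φ q
  extend-≈P φ p q p≈q = begin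
    extend φ p                     ≈⟨ extend-via-coeff φ p ms unique (λ m∈ → ∈-deduplicate⁺ _≟ₘ_ (∈-++⁺ˡ m∈)) ⟩
    ∑ₗ ms (λ m → coeff p m * φ m)  ≈⟨ ∑ₗ-cong ms (λ m → *-congʳ (p≈q m)) ⟩
    ∑ₗ ms (λ m → coeff q m * φ m)  ≈⟨ sym (extend-via-coeff φ q ms unique λ m∈ →
                                         ∈-deduplicate⁺ _≟ₘ_ (∈-++⁺ʳ (monomials p) m∈)) ⟩
    extend φ q                     ∎
    where
    ms : List Monomial
    ms = deduplicate _≟ₘ_ (monomials p ++ monomials q)
    unique : Unique ms
    unique = deduplicate-! _≟ₘ_ (monomials p ++ monomials q)

  extend-vanishes : ∀ φ p → (∀ m → coeff p m * φ m ≈ 0#) → extend φ p ≈ 0#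
  extend-vanishes φ p coeff·φ≈0 =
    trans (extend-via-coeff φ p ms (deduplicate-! _≟ₘ_ (monomials p)) (∈-deduplicate⁺ _≟ₘ_)) (∑ₗ-zero ms coeff·φ≈0)
    where
    ms : List Monomial
    ms = deduplicate _≟ₘ_ (monomials p)

  extend-mulX : ∀ i (F : Monomial → Fn) p S → extend (λ m → mulX i (F m) S) p ≈ mulX i (λ T → extend (λ m → F m T) p) S
  extend-mulX i F p S =
    trans (extend-* (𝟙 (lookup S i)) _ p) (*-congˡ (extend-+ (λ m → F m S) (λ m → F m (S [ i ]≔ outside)) p))

  extend-mulL : ∀ (F : Monomial → Fn) p S → extend (λ m → mulL (F m) S) p ≈ mulL (λ T → extend (λ m → F m T) p) S
  extend-mulL F p S = trans (extend-+ _ (λ m → F m S) p)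
    (+-congʳ (trans (extend-∑ (λ i m → mulX i (F m) S) p) (sum-cong-≋ (λ i → extend-mulX i F p S))))

  -- reduce p S is the coefficient of ∏_{i ∈ S} x_i in p modulo x_i² = x_i, which sends x^m to x^(support m).
  reduce : Poly → Fn
  reduce p S = extend (λ m → δ (support m) S) p

  one : Fn
  one = δ ⊥

  reduce-+P : ∀ p q → reduce (p +P q) ≐ λ S → reduce p S + reduce q S
  reduce-+P p q S = extend-+P _ p q

  reduce-scale : ∀ a p → reduce (scale a p) ≐ λ S → a * reduce p S
  reduce-scale a p S = extend-scale _ a p

  reduce-≈P : ∀ p q → p ≈P q → reduce p ≐ reduce q
  reduce-≈P p q p≈q S = extend-≈P _ p q p≈q

  δ-support-⊞unit : ∀ m i S → δ (support (m ⊞ unit n i)) S ≈ mulX i (δ (support m)) S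
  δ-support-⊞unit m i S =
    trans (reflexive (≡.cong (λ T → δ T S) (support-⊞unit m i))) (δ-insert (support m) i S)

  reduce-mulVar : ∀ p i → reduce (mulVar p i) ≐ mulX i (reduce p)
  reduce-mulVar p i S = begin
    reduce (mulVar p i) S                        ≈⟨ extend-*var _ p i ⟩
    extend (λ m → δ (support (m ⊞ unit n i)) S) p ≈⟨ extend-cong p (λ m → δ-support-⊞unit m i S) ⟩
    extend (λ m → mulX i (δ (support m)) S) p     ≈⟨ extend-mulX i (λ m → δ (support m)) p S ⟩
    mulX i (reduce p) S                          ∎

  δ-support-*sumVars+1 : ∀ m S → extend (λ m′ → δ (support (m ⊞ m′)) S) sumVars+1 ≈ mulL (δ (support m)) S
  δ-support-*sumVars+1 m S = trans (extend-sumVars+1 _)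
    (+-cong (sum-cong-≋ (λ i → δ-support-⊞unit m i S))
            (reflexive (≡.cong (λ m′ → δ (support m′) S) (⊞-identityʳ m))))

  reduce-*sumVars+1 : ∀ p → reduce (p *P sumVars+1) ≐ mulL (reduce p)
  reduce-*sumVars+1 p S = begin
    reduce (p *P sumVars+1) S
      ≈⟨ extend-*P _ p sumVars+1 ⟩
    extend (λ m → extend (λ m′ → δ (support (m ⊞ m′)) S) sumVars+1) p
      ≈⟨ extend-cong p (λ m → δ-support-*sumVars+1 m S) ⟩
    extend (λ m → mulL (δ (support m)) S) p
      ≈⟨ extend-mulL (λ m → δ (support m)) p S ⟩
    mulL (reduce p) S ∎

  reduce-sumVars+1 : reduce sumVars+1 ≐ mulL one
  reduce-sumVars+1 S = begin
    extend (λ m → δ (support m) S) sumVars+1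
      ≈⟨ extend-cong sumVars+1 (λ m → reflexive (≡.cong (λ m′ → δ (support m′) S) (≡.sym (⊞-identityˡ m)))) ⟩
    extend (λ m → δ (support (replicate n 0 ⊞ m)) S) sumVars+1
      ≈⟨ δ-support-*sumVars+1 (replicate n 0) S ⟩
    mulL (δ (support (replicate n 0))) S
      ≡⟨ ≡.cong (λ T → mulL (δ T) S) (support-0 n) ⟩
    mulL one S ∎

  reduce-sumVars+1² : reduce (sumVars+1 *P sumVars+1) ≐ mulL (mulL one)
  reduce-sumVars+1² S = trans (reduce-*sumVars+1 sumVars+1 S) (mulL-cong reduce-sumVars+1 S)

  reduce-var : ∀ i → reduce (var i) ≐ δ (⊥ [ i ]≔ inside)
  reduce-var i S = trans (+-identityʳ _) (trans (*-identityˡ _) (reflexive (≡.cong (λ T → δ T S) support-unit)))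
    where
    support-unit : support (unit n i) ≡ ⊥ [ i ]≔ inside
    support-unit = ≡.trans (≡.cong support (≡.sym (⊞-identityˡ (unit n i))))
                           (≡.trans (support-⊞unit (replicate n 0) i) (≡.cong (_[ i ]≔ inside) (support-0 n)))

  reduce-boolean : ∀ i → reduce ((var i *P var i) +P scale (- 1#) (var i)) ≐ 0F
  reduce-boolean i S = begin
    reduce ((var i *P var i) +P scale (- 1#) (var i)) S
      ≈⟨ trans (reduce-+P (var i *P var i) (scale (- 1#) (var i)) S)
               (+-cong (reduce-mulVar (var i) i S) (reduce-scale (- 1#) (var i) S)) ⟩
    mulX i (reduce (var i)) S + - 1# * reduce (var i) S
      ≈⟨ +-cong (mulX-cong i (reduce-var i) S) (*-congˡ (reduce-var i S)) ⟩
    mulX i (δ sᵢ) S + - 1# * δ sᵢ S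
      ≈⟨ +-congʳ (sym (δ-insert sᵢ i S)) ⟩
    δ (sᵢ [ i ]≔ inside) S + - 1# * δ sᵢ S
      ≡⟨ ≡.cong (λ T → δ T S + - 1# * δ sᵢ S) ([]≔-idempotent ⊥ i) ⟩
    δ sᵢ S + - 1# * δ sᵢ S
      ≈⟨ +-congˡ (-1*x≈-x _) ⟩
    δ sᵢ S - δ sᵢ S
      ≈⟨ -‿inverseʳ _ ⟩
    0# ∎
    where
    sᵢ : Subset n
    sᵢ = ⊥ [ i ]≔ inside

  reduce-degree : ∀ p u → (∀ m → u ≤ totalDeg m → coeff p m ≈ 0#) → ∀ S → u ≤ ∣ S ∣ → reduce p S ≈ 0#
  reduce-degree p u high≈0 S u≤∣S∣ = extend-vanishes _ p term≈0
    where
    term≈0 : ∀ m → coeff p m * δ (support m) S ≈ 0#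
    term≈0 m with ≡-dec Bool._≟_ (support m) S
    ... | yes ≡.refl = trans (*-congʳ (high≈0 m (ℕ.≤-trans u≤∣S∣ (∣support∣≤sum m)))) (zeroˡ _)
    ... | no  _      = zeroʳ _

  coeff-mulVar : ∀ p i m → coeff (mulVar p i) (m ⊞ unit n i) ≈ coeff p m
  coeff-mulVar p i m = begin
    coeff (mulVar p i) (m ⊞ unit n i)                        ≈⟨ coeff-as-extend (mulVar p i) _ ⟩
    extend (λ m′ → δₘ m′ (m ⊞ unit n i)) (p *P var i)        ≈⟨ extend-*var _ p i ⟩
    extend (λ m′ → δₘ (m′ ⊞ unit n i) (m ⊞ unit n i)) p      ≈⟨ extend-cong p (λ m′ →
                                                                  δₘ-⇔ (mk⇔ (⊞unit-injective m′ m i) (≡.cong (_⊞ unit n i)))) ⟩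
    extend (λ m′ → δₘ m′ m) p                                ≈⟨ sym (coeff-as-extend p m) ⟩
    coeff p m                                                ∎

  one-degree : ∀ t → DegreeAtMost t one
  one-degree t S t<∣S∣ = δ-≢ {⊥} {S} λ ⊥≡S →
    ℕ.<⇒≢ (ℕ.≤-<-trans z≤n t<∣S∣) (≡.trans (≡.sym (∣⊥∣≡0 n)) (≡.cong ∣_∣ ⊥≡S))

  one-⊥ : one ⊥ ≈ 1#
  one-⊥ = δ-refl ⊥

module Refutation {c ℓ} (R : CommutativeRing c ℓ) (torsionFree : TorsionFree R)
                  (n t : ℕ) (room : 3 ℕ.+ (t ℕ.+ t) ≤ n) where
  open CommutativeRing R hiding (zero)
  open import Relation.Binary.Reasoning.Setoid setoid
  open PC R n
  open RingLemmas R
  open Monomials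
  open BooleanCube R n
  open UpInjective torsionFree
  open Reduction R n

  L²Multiple : Poly → Set (c ⊔ ℓ)
  L²Multiple p = Σ[ q ∈ Fn ] DegreeAtMost t q × (reduce p ≐ mulL (mulL q))

  vanishing-L²Multiple : ∀ p → reduce p ≐ 0F → L²Multiple p
  vanishing-L²Multiple p p≐0 = 0F , (λ _ _ → refl) , (λ S → trans (p≐0 S) (sym (mulL-zero (mulL-zero (λ _ → refl)) S)))

  axiom-L²Multiple : ∀ p → Axioms p → L²Multiple p
  axiom-L²Multiple p (inj₁ (i , p≈)) = vanishing-L²Multiple p λ S →
    trans (reduce-≈P p ((var i *P var i) +P scale (- 1#) (var i)) p≈ S) (reduce-boolean i S)
  axiom-L²Multiple p (inj₂ p≈) = one , one-degree t , λ S →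
    trans (reduce-≈P p (sumVars+1 *P sumVars+1) p≈ S) (reduce-sumVars+1² S)

  combination-L²Multiple : ∀ {p p₁ p₂} a b → L²Multiple p₁ → L²Multiple p₂ →
                           p ≈P (scale a p₁ +P scale b p₂) → L²Multiple p
  combination-L²Multiple {p} {p₁} {p₂} a b (q₁ , deg₁ , eq₁) (q₂ , deg₂ , eq₂) p≈ =
    q , (λ S t<∣S∣ → ≈0+≈0 (*-≈0ʳ (deg₁ S t<∣S∣)) (*-≈0ʳ (deg₂ S t<∣S∣))) , λ S → begin
      reduce p S                                        ≈⟨ reduce-≈P p (scale a p₁ +P scale b p₂) p≈ S ⟩
      reduce (scale a p₁ +P scale b p₂) S               ≈⟨ trans (reduce-+P (scale a p₁) (scale b p₂) S)
                                                                 (+-cong (reduce-scale a p₁ S) (reduce-scale b p₂ S)) ⟩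
      a * reduce p₁ S + b * reduce p₂ S                 ≈⟨ +-cong (*-congˡ (eq₁ S)) (*-congˡ (eq₂ S)) ⟩
      a * mulL (mulL q₁) S + b * mulL (mulL q₂) S       ≈⟨ sym (mulL-linear a (mulL q₁) b (mulL q₂) S) ⟩
      mulL (λ T → a * mulL q₁ T + b * mulL q₂ T) S      ≈⟨ mulL-cong (λ T → sym (mulL-linear a q₁ b q₂ T)) S ⟩
      mulL (mulL q) S                                   ∎
    where
    q : Fn
    q T = a * q₁ T + b * q₂ T

  -- The degree bound on x_i · p forces L² q to vanish in degree t + 2, hence q in degree t, so x_i q still has degree ≤ t.
  mulVar-L²Multiple : ∀ {p p′} i → DegLE p (2 ℕ.+ t) → L²Multiple p′ → p ≈P mulVar p′ i → L²Multiple p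
  mulVar-L²Multiple {p} {p′} i deg-p (q , deg-q , eq) p≈ = mulX i q , mulX-degree t q i deg-q q-level-t , λ S → begin
    reduce p S                      ≈⟨ reduce-≈P p (mulVar p′ i) p≈ S ⟩
    reduce (mulVar p′ i) S          ≈⟨ reduce-mulVar p′ i S ⟩
    mulX i (reduce p′) S            ≈⟨ mulX-cong i eq S ⟩
    mulX i (mulL (mulL q)) S        ≈⟨ mulX-mulL i (mulL q) S ⟩
    mulL (mulX i (mulL q)) S        ≈⟨ mulL-cong (mulX-mulL i q) S ⟩
    mulL (mulL (mulX i q)) S        ∎
    where
    high-p′ : ∀ m → 2 ℕ.+ t ≤ totalDeg m → coeff p′ m ≈ 0#
    high-p′ m le = trans (sym (coeff-mulVar p′ i m))
      (trans (sym (p≈ (m ⊞ unit n i))) (deg-p _ (ℕ.≤-trans (s≤s le) (ℕ.≤-reflexive (≡.sym (sum-⊞unit m i))))))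
    q-level-t : ∀ S → ∣ S ∣ ≡ t → q S ≈ 0#
    q-level-t = level-vanishing 2 t q deg-q
      (λ S ∣S∣≡2+t → trans (sym (eq S)) (reduce-degree p′ (2 ℕ.+ t) high-p′ S (ℕ.≤-reflexive (≡.sym ∣S∣≡2+t))))
      (ℕ.≤-trans (ℕ.≤-reflexive (ℕ.+-comm (t ℕ.+ t) 2)) (ℕ.≤-trans (ℕ.n≤1+n _) room))

  module _ (D : Derivation Axioms) (deg : DerivDegLE D (2 ℕ.+ t)) where
    open Derivation D

    line-L²Multiple : ∀ fuel j → Fin.toℕ j < fuel → L²Multiple (line j)
    line-L²Multiple zero       j ()
    line-L²Multiple (suc fuel) j j<1+fuel with just j
    ... | inj₁ axiom = axiom-L²Multiple (line j) axiom
    ... | inj₂ (inj₁ line≈0) = vanishing-L²Multiple (line j) (reduce-≈P (line j) 0P line≈0)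
    ... | inj₂ (inj₂ (inj₁ (k , k′ , a , b , k<j , k′<j , line≈))) =
      combination-L²Multiple {line j} {line k} {line k′} a b
        (line-L²Multiple fuel k (earlier k<j)) (line-L²Multiple fuel k′ (earlier k′<j)) line≈
      where
      earlier : ∀ {x} → x < Fin.toℕ j → x < fuel
      earlier x<j = ℕ.<-≤-trans x<j (ℕ.≤-pred j<1+fuel)
    ... | inj₂ (inj₂ (inj₂ (k , i , k<j , line≈))) =
      mulVar-L²Multiple {line j} {line k} i (deg j) (line-L²Multiple fuel k earlier) line≈
      where
      earlier : Fin.toℕ k < fuel
      earlier = ℕ.<-≤-trans k<j (ℕ.≤-pred j<1+fuel)

    -- From L = L² q: L (1 − L q) = 0 gives 1 = L q, and then L q = 0 in positive degrees gives q = 0.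
    refutation⇒trivial : conclusion ≈P sumVars+1 → 1# ≈ 0#
    refutation⇒trivial conclusion≈ =
      trivial (line-L²Multiple (suc len) (Fin.fromℕ len) (s≤s (ℕ.≤-reflexive (Fin.toℕ-fromℕ len))))
      where
      trivial : L²Multiple conclusion → 1# ≈ 0#
      trivial (q , deg-q , eq) = begin
        1#        ≈⟨ sym one-⊥ ⟩
        one ⊥     ≈⟨ one≐Lq ⊥ ⟩
        mulL q ⊥  ≈⟨ mulL-zero q≐0 ⊥ ⟩
        0#        ∎
        where
        r : Fn
        r S = 1# * one S + - 1# * mulL q S
        Lr≐0 : mulL r ≐ 0F
        Lr≐0 S = trans (mulL-linear 1# one (- 1#) (mulL q) S)
          (difference≈0 (trans (sym (trans (reduce-≈P conclusion sumVars+1 conclusion≈ S) (reduce-sumVars+1 S))) (eq S)))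
        one≐Lq : one ≐ mulL q
        one≐Lq S = difference≈0⇒≈ (mulL-injective (suc t) r
          (λ S t<∣S∣ → ≈0+≈0 (*-≈0ʳ (one-degree (suc t) S t<∣S∣)) (*-≈0ʳ (mulL-degree t q deg-q S t<∣S∣)))
          (λ S _ → Lr≐0 S)
          (ℕ.≤-trans (ℕ.≤-reflexive (≡.cong (λ x → suc (suc x)) (ℕ.+-suc t t))) room) S)
        q≐0 : q ≐ 0F
        q≐0 = mulL-injective t q deg-q (λ S 1≤∣S∣ → trans (sym (one≐Lq S)) (one-degree 0 S 1≤∣S∣))
                             (ℕ.≤-trans (ℕ.n≤1+n _) (ℕ.≤-trans (ℕ.n≤1+n _) room))

field⇒torsionFree : ∀ {c ℓ} (R : CommutativeRing c ℓ) → IsField R → CharZero R → TorsionFree R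
field⇒torsionFree R isField charZero m x m·x≈0 with IsField.inverse isField (natR R (suc m)) (charZero m)
... | y , m·y≈1 = begin
  x                          ≈⟨ sym (*-identityˡ x) ⟩
  1# * x                     ≈⟨ *-congʳ (sym m·y≈1) ⟩
  (natR R (suc m) * y) * x   ≈⟨ *-congʳ (*-comm _ y) ⟩
  (y * natR R (suc m)) * x   ≈⟨ *-assoc y _ x ⟩
  y * (natR R (suc m) * x)   ≈⟨ *-congˡ m·x≈0 ⟩
  y * 0#                     ≈⟨ zeroʳ y ⟩
  0#                         ∎
  where
  open CommutativeRing R
  open import Relation.Binary.Reasoning.Setoid setoid

n≰2d⇒3+2[d∸2]≤n : ∀ n d → 3 ≤ n → ¬ n ≤ 2 ℕ.* d → 3 ℕ.+ ((d ∸ 2) ℕ.+ (d ∸ 2)) ≤ n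
n≰2d⇒3+2[d∸2]≤n n zero          3≤n _    = 3≤n
n≰2d⇒3+2[d∸2]≤n n (suc zero)    3≤n _    = 3≤n
n≰2d⇒3+2[d∸2]≤n n (suc (suc d)) _   n≰2d =
  ℕ.≤-trans (ℕ.m≤n+m _ 2) (ℕ.≤-trans (ℕ.≤-reflexive (shift d)) (ℕ.≰⇒> n≰2d))
  where
  open import Data.Nat.Tactic.RingSolver using (solve-∀)
  shift : ∀ d → 2 ℕ.+ (3 ℕ.+ (d ℕ.+ d)) ≡ suc (2 ℕ.* suc (suc d))
  shift = solve-∀

open import Data.Nat using (_*_)

proposition2p13 : ∀ {c ℓ} (R : CommutativeRing c ℓ) → IsField R → CharZero R →
    ∃[ k ] ∃[ n₀ ] (1 ≤ k × (∀ n → n₀ ≤ n →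
      (D : PC.DerivationOf R n (PC.Axioms R n) (PC.sumVars+1 R n)) →
      ∀ d → PC.DerivDegLE R n (proj₁ D) d → n ≤ k * d))
proposition2p13 R isField charZero = 2 , 3 , s≤s z≤n , bound
  where
  bound : ∀ n → 3 ≤ n → (D : PC.DerivationOf R n (PC.Axioms R n) (PC.sumVars+1 R n)) →
          ∀ d → PC.DerivDegLE R n (proj₁ D) d → n ≤ 2 * d
  bound n 3≤n (D , D⊢L) d deg with n ℕ.≤? 2 * d
  ... | yes n≤2d = n≤2d
  ... | no  n≰2d = ⊥-elim (IsField.1≉0 isField (refutation⇒trivial D deg′ D⊢L))
    where
    open Refutation R (field⇒torsionFree R isField charZero) n (d ∸ 2) (n≰2d⇒3+2[d∸2]≤n n d 3≤n n≰2d)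
    deg′ : PC.DerivDegLE R n D (2 ℕ.+ (d ∸ 2))
    deg′ j m 2+[d∸2]<∣m∣ = deg j m (ℕ.≤-<-trans (ℕ.m≤n+m∸n d 2) 2+[d∸2]<∣m∣)
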